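{- Let $G$ be a connected bridgeless graph. If every edge of $G$ is contained in a triangle, then $rc(G)\leq 3\,rad(G)$.
   Context: All graphs are finite, simple and undirected. $d(x,y)$ is the length of a shortest path between $x$ and $y$; the eccentricity of $x$ is $ecc(x)=\max_{y\in V(G)} d(x,y)$, and the radius is $rad(G)=\min_{x\in V(G)} ecc(x)$. In an edge-colored graph (adjacent edges may share a color), a path is rainbow if no two of its edges have the same color. The rainbow connection number $rc(G)$ of a connected graph $G$ is the smallest integer $k$ for which there is an edge-coloring of $G$ with $k$ colors such that every pair of distinct vertices of $G$ is joined by a rainbow path. A graph is bridgeless if it has no edge whose removal disconnects it. -}

module Defs where

open import Data.Nat using (ℕ; zero; suc; _≤_)
open import Data.Fin using (Fin; _≟_)
open import Data.Bool using (Bool; true; false; _∧_; not; _∨_)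
open import Data.List using (List; []; _∷_)
open import Data.List.Relation.Unary.Unique.Propositional using (Unique)
open import Data.Product using (Σ; ∃; ∃-syntax; _×_; _,_)
open import Relation.Binary.PropositionalEquality using (_≡_)
open import Relation.Nullary using (¬_)
open import Relation.Nullary.Decidable using (⌊_⌋)

record Graph : Set where
  field
    n      : ℕ
    adj    : Fin n → Fin n → Bool
    sym    : ∀ u v → adj u v ≡ adj v u
    irrefl : ∀ u → adj u u ≡ false

open Graph public

module _ (G : Graph) where

  Vertex : Set
  Vertex = Fin (n G)

  Edge : Vertex → Vertex → Set
  Edge u v = adj G u v ≡ true

  data Walk : Vertex → Vertex → Set where
    []  : ∀ {x} → Walk x x
    _∷_ : ∀ {x z y} → Edge x z → Walk z y → Walk x y

  len : ∀ {x y} → Walk x y → ℕ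
  len []      = 0
  len (_ ∷ w) = suc (len w)

  vertices : ∀ {x y} → Walk x y → List Vertex
  vertices {x} []      = x ∷ []
  vertices {x} (_ ∷ w) = x ∷ vertices w

  IsPath : ∀ {x y} → Walk x y → Set
  IsPath w = Unique (vertices w)

  Connected : Set
  Connected = ∀ (x y : Vertex) → Walk x y

  Dist : Vertex → Vertex → ℕ → Set
  Dist x y k = (Σ (Walk x y) λ w → len w ≡ k)
             × (∀ (w : Walk x y) → k ≤ len w)

  Ecc : Vertex → ℕ → Set
  Ecc x e = (∀ y k → Dist x y k → k ≤ e) × (∃[ y ] Dist x y e)

  Rad : ℕ → Set
  Rad r = (∃[ x ] Ecc x r) × (∀ x e → Ecc x e → r ≤ e)

  EveryEdgeInTriangle : Set
  EveryEdgeInTriangle = ∀ u v → Edge u v → ∃[ w ] (Edge u w × Edge v w)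

  -- edge-colorings with colors from Fin k (adjacent edges may share a color)
  record EdgeColoring (k : ℕ) : Set where
    field
      col    : ∀ u v → Edge u v → Fin k
      col-sym : ∀ u v (e : Edge u v) (e' : Edge v u) → col u v e ≡ col v u e'

  colours : ∀ {k} → EdgeColoring k → ∀ {x y} → Walk x y → List (Fin k)
  colours c []               = []
  colours c (_∷_ {x} {z} e w) = EdgeColoring.col c x z e ∷ colours c w

  IsRainbow : ∀ {k} → EdgeColoring k → ∀ {x y} → Walk x y → Set
  IsRainbow c w = Unique (colours c w)

  RainbowConnected : ∀ {k} → EdgeColoring k → Set
  RainbowConnected c = ∀ (x y : Vertex) → ¬ x ≡ y →
    Σ (Walk x y) λ w → IsPath w × IsRainbow c w

  rc≤ : ℕ → Set
  rc≤ k = Σ (EdgeColoring k) RainbowConnected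

deleteEdge : (G : Graph) → Fin (n G) → Fin (n G) → Graph
deleteEdge G u v = record
  { n      = n G
  ; adj    = λ a b → adj G a b ∧ not (same a b)
  ; sym    = symP
  ; irrefl = irr
  }
  where
    same : Fin (n G) → Fin (n G) → Bool
    same a b = (⌊ a ≟ u ⌋ ∧ ⌊ b ≟ v ⌋) ∨ (⌊ a ≟ v ⌋ ∧ ⌊ b ≟ u ⌋)
    open import Data.Bool.Properties using (∨-comm)
    open import Relation.Binary.PropositionalEquality using (cong₂; cong; trans)
    symP : ∀ a b → (adj G a b ∧ not (same a b)) ≡ (adj G b a ∧ not (same b a))
    symP a b = cong₂ _∧_ (sym G a b) (cong not (trans (∨-comm (⌊ a ≟ u ⌋ ∧ ⌊ b ≟ v ⌋) _) (cong₂ _∨_ (∧-comm ⌊ a ≟ v ⌋ _) (∧-comm ⌊ a ≟ u ⌋ _))))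
      where
        open import Data.Bool.Properties using (∧-comm)
    irr : ∀ a → (adj G a a ∧ not (same a a)) ≡ false
    irr a rewrite irrefl G a = Relation.Binary.PropositionalEquality.refl
      where import Relation.Binary.PropositionalEquality

Bridgeless : Graph → Set
Bridgeless G = ∀ u v → Edge G u v → Connected (deleteEdge G u v)

-- Fix a vertex x of eccentricity r and sort the vertices into levels by their distance
-- from x.  An edge between levels i and i+1 gets colour 3i or 3i+1, an edge inside
-- level i+1 gets 3i+2.  Split the vertices by a maximal independent set of the
-- same-level edges; a vertex w of level i+1 gives the edge to its BFS parent the colour
-- 3i + side w (sides read as 0 and 1) and its other downward edges the other one.
-- By induction on i, any two vertices of level ≤ i are joined by a rainbow walk with
-- colours below 3i: u steps to its parent, and v reaches level i avoiding that colour,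
-- either by its own parent edge or, when that edge has the same colour, through the
-- triangle on it.  The third vertex is one level down (a non-parent edge), or on the
-- same level, and then v has a same-level neighbour on the other side, whose parent
-- edge has the other colour.  A rainbow walk shortcuts to a rainbow path.

module Submission where

open import Defs hiding (sym)
open import Data.Nat using (ℕ; zero; suc; pred; _+_; _*_; _≤_; _<_; z≤n; s≤s)
open import Data.Nat.Properties
  using (_≟_; <-cmp; ≤-refl; ≤-reflexive; ≤-trans; ≤-antisym; <-≤-trans; ≤-total; ≮⇒≥; n≤0⇒n≡0; ≤-pred;
         m≤n⇒m<n∨m≡n; m<1+n⇒m≤n; anyUpTo?; suc-injective; +-comm; +-cancelˡ-≡; m≤m+n;
         +-monoʳ-<; *-monoʳ-≤; *-suc; n≤1+n; 1+n≰n; <-asym; <-irrefl; module ≤-Reasoning)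
open import Data.Nat.Induction using (<-wellFounded)
open import Data.Fin using (Fin; fromℕ<; toℕ)
import Data.Fin as Fin
open import Data.Fin.Properties using (any?; fromℕ<-cong; toℕ-fromℕ<)
open import Data.Bool using (Bool; true; false; not; if_then_else_; _∨_)
import Data.Bool.Properties as Bool
open import Data.List using (List; []; _∷_; _++_; map; reverse; allFin)
open import Data.List.Properties using (unfold-reverse)
open import Data.List.Membership.Propositional using (_∈_; _∉_)
import Data.List.Membership.DecPropositional as DecMembership
open import Data.List.Membership.Propositional.Properties using (∈-++⁻; ∈-map⁻; ∈-allFin)
open import Data.List.Relation.Unary.Any using (here; there)
open import Data.List.Relation.Unary.All as All using (All; []; _∷_)
import Data.List.Relation.Unary.All.Properties as All
open import Data.List.Relation.Unary.AllPairs using ([]; _∷_)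
open import Data.List.Relation.Unary.Unique.Propositional using (Unique)
import Data.List.Relation.Unary.Unique.Propositional.Properties as Unique
open import Data.List.Relation.Binary.Disjoint.Propositional using (Disjoint)
open import Data.List.Relation.Binary.Subset.Propositional using (_⊆_)
open import Data.List.Relation.Binary.Permutation.Propositional using (↭-sym; ↭⇒↭ₛ)
open import Data.List.Relation.Binary.Permutation.Propositional.Properties
  using (↭-reverse; All-resp-↭; ∈-resp-↭)
import Data.List.Relation.Binary.Permutation.Setoid.Properties as Perm
open import Data.Product using (Σ; ∃; ∃-syntax; _×_; _,_; proj₁; proj₂)
open import Data.Sum using (_⊎_; inj₁; inj₂)
import Data.Sum as Sum
open import Data.Empty using (⊥-elim)
open import Function using (_∘_; id)
open import Induction.WellFounded using (Acc; acc)
open import Relation.Binary.Definitions using (tri<; tri≈; tri>)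
open import Relation.Binary.PropositionalEquality
  using (_≡_; _≢_; refl; sym; trans; cong; cong₂; subst; subst₂; setoid; module ≡-Reasoning)
open import Relation.Nullary using (¬_; Dec; yes; no; _×-dec_; contradiction)
open import Relation.Nullary.Decidable using (⌊_⌋)
open import Relation.Unary using (Decidable)

least-witness : {P : ℕ → Set} → Decidable P → ∀ {b} → P b →
  ∃[ k ] P k × (∀ {j} → j < k → ¬ P j)
least-witness {P} P? = go (<-wellFounded _)
  where
  go : ∀ {b} → Acc _<_ b → P b → ∃[ k ] P k × (∀ {j} → j < k → ¬ P j)
  go {b} (acc smaller) pb with anyUpTo? P? b
  ... | yes (j , j<b , pj) = go (smaller j<b) pj
  ... | no none            = b , pb , λ j<b pj → none (_ , j<b , pj)

module _ {m : ℕ} {P : Fin m → Set} (P? : Decidable P) where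

  choose : Fin m → Fin m
  choose default with any? P?
  ... | yes (a , _) = a
  ... | no _        = default

  choose-satisfies : ∀ default → ∃ P → P (choose default)
  choose-satisfies default ∃P with any? P?
  ... | yes (_ , pa) = pa
  ... | no ∄P        = ⊥-elim (∄P ∃P)

module _ {A : Set} where

  Unique-reverse : ∀ {xs : List A} → Unique xs → Unique (reverse xs)
  Unique-reverse {xs} = Perm.Unique-resp-↭ (setoid A) (↭⇒↭ₛ (↭-sym (↭-reverse xs)))

  All-reverse : ∀ {P : A → Set} {xs : List A} → All P xs → All P (reverse xs)
  All-reverse {xs = xs} = All-resp-↭ (↭-sym (↭-reverse xs))

  ∈-reverse⁻ : ∀ {x} {xs : List A} → x ∈ reverse xs → x ∈ xs
  ∈-reverse⁻ {xs = xs} = ∈-resp-↭ (↭-reverse xs)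

≤-suc-cases : ∀ {m n} → m ≤ suc n → m ≤ n ⊎ m ≡ suc n
≤-suc-cases = Sum.map₁ m<1+n⇒m≤n ∘ m≤n⇒m<n∨m≡n

InRange : ℕ → ℕ → ℕ → Set
InRange a b c = a ≤ c × c < b

++-unique-inRange : ∀ {a b} {xs ms ys : List ℕ} → a ≤ b →
  Unique xs → All (InRange a b) xs → Unique ms → All (_< a) ms →
  Unique ys → All (InRange a b) ys → Disjoint xs ys →
  Unique (xs ++ ms ++ ys) × All (_< b) (xs ++ ms ++ ys)
++-unique-inRange {a} {b} {xs} {ms} {ys} a≤b uxs rxs ums bms uys rys xs#ys =
  Unique.++⁺ uxs (Unique.++⁺ ums uys ms#ys) xs#ms++ys ,
  All.++⁺ (All.map proj₂ rxs) (All.++⁺ (All.map (λ c<a → <-≤-trans c<a a≤b) bms) (All.map proj₂ rys))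
  where
  <⇒¬InRange : ∀ {c} → c < a → ¬ InRange a b c
  <⇒¬InRange c<a (a≤c , _) = 1+n≰n (≤-trans c<a a≤c)
  ms#ys : Disjoint ms ys
  ms#ys (p , q) = <⇒¬InRange (All.lookup bms p) (All.lookup rys q)
  xs#ms++ys : Disjoint xs (ms ++ ys)
  xs#ms++ys (p , q) with ∈-++⁻ ms q
  ... | inj₁ q′ = <⇒¬InRange (All.lookup bms q′) (All.lookup rxs p)
  ... | inj₂ q′ = xs#ys (p , q′)

bit : Bool → ℕ
bit false = 0
bit true  = 1

bit≤2 : ∀ b → bit b ≤ 2
bit≤2 false = z≤n
bit≤2 true  = s≤s z≤n

bit≢2 : ∀ b → bit b ≢ 2
bit≢2 false ()
bit≢2 true  ()

bit-not≢ : ∀ b → bit b ≢ bit (not b)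
bit-not≢ false ()
bit-not≢ true  ()

Band : ℕ → ℕ → Set
Band i = InRange (3 * i) (3 * suc i)

inBand : ∀ i {d} → d ≤ 2 → Band i (3 * i + d)
inBand i {d} d≤2 = m≤m+n (3 * i) d , (begin-strict
  3 * i + d   <⟨ +-monoʳ-< (3 * i) (s≤s d≤2) ⟩
  3 * i + 3   ≡⟨ +-comm (3 * i) 3 ⟩
  3 + 3 * i   ≡⟨ *-suc 3 i ⟨
  3 * suc i   ∎)
  where open ≤-Reasoning

bit-inBand : ∀ i b → Band i (3 * i + bit b)
bit-inBand i b = inBand i (bit≤2 b)

digits-inBand : ∀ i {c ds} → All (_≤ 2) ds → Unique ds → c ∉ ds →
  Unique (map (3 * i +_) ds) × All (Band i) (map (3 * i +_) ds) × 3 * i + c ∉ map (3 * i +_) ds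
digits-inBand i {c} {ds} ds≤2 uds c∉ds =
  Unique.map⁺ (+-cancelˡ-≡ (3 * i) _ _) uds ,
  All.map⁺ (All.map (inBand i) ds≤2) ,
  λ c∈ → let (d , d∈ds , eq) = ∈-map⁻ (3 * i +_) c∈
         in c∉ds (subst (_∈ ds) (sym (+-cancelˡ-≡ (3 * i) _ _ eq)) d∈ds)

module _ {n : ℕ} {R : Fin n → Fin n → Set} (R? : ∀ a b → Dec (R a b))
         (R-sym : ∀ {a b} → R a b → R b a) (R-irrefl : ∀ {a} → ¬ R a a) where

  Independent : (Fin n → Bool) → Set
  Independent I = ∀ {a b} → I a ≡ true → I b ≡ true → ¬ R a b

  Dominates : List (Fin n) → (Fin n → Bool) → Set
  Dominates L I = ∀ {j} → j ∈ L → I j ≡ false → ∃[ z ] R j z × I z ≡ true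

  greedy-maximal-independent : ∀ L → ∃[ I ] Independent I × Dominates L I
  greedy-maximal-independent [] = (λ _ → false) , (λ ()) , (λ ())
  greedy-maximal-independent (f ∷ L) with greedy-maximal-independent L
  ... | I , indep , dom with any? (λ z → R? f z ×-dec (I z Bool.≟ true))
  ...   | yes (z , fRz , Iz) = I , indep , λ { (here refl) _ → z , fRz , Iz ; (there j∈L) → dom j∈L }
  ...   | no ∄ = I′ , indep′ , dom′
    where
    I′ : Fin n → Bool
    I′ j = ⌊ j Fin.≟ f ⌋ ∨ I j

    I′-true : ∀ {j} → I′ j ≡ true → j ≡ f ⊎ I j ≡ true
    I′-true {j} eq with j Fin.≟ f
    ... | yes j≡f = inj₁ j≡f
    ... | no _    = inj₂ eq

    I′-extends : ∀ {j} → I j ≡ true → I′ j ≡ true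
    I′-extends {j} eq with j Fin.≟ f
    ... | yes _ = refl
    ... | no _  = eq

    indep′ : Independent I′
    indep′ {a} {b} Ia Ib aRb with I′-true Ia | I′-true Ib
    ... | inj₁ refl | inj₁ refl = R-irrefl aRb
    ... | inj₁ refl | inj₂ Ib′  = ∄ (b , aRb , Ib′)
    ... | inj₂ Ia′  | inj₁ refl = ∄ (a , R-sym aRb , Ia′)
    ... | inj₂ Ia′  | inj₂ Ib′  = indep Ia′ Ib′ aRb

    dom′ : Dominates (f ∷ L) I′
    dom′ {j} (here refl) I′j with j Fin.≟ j
    ... | yes _  = contradiction I′j λ ()
    ... | no j≢j = ⊥-elim (j≢j refl)
    dom′ {j} (there j∈L) I′j with j Fin.≟ f | dom j∈L
    ... | yes _ | _ = contradiction I′j λ ()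
    ... | no _  | dom-j with dom-j I′j
    ...   | z , jRz , Iz = z , jRz , I′-extends Iz

  neighbour-on-other-side :
    ∃[ side ] (∀ {w z} → R w z → ∃[ y ] R w y × side y ≡ not (side w))
  neighbour-on-other-side with greedy-maximal-independent (allFin n)
  ... | I , indep , dom = I , other
    where
    other : ∀ {w z} → R w z → ∃[ y ] R w y × I y ≡ not (I w)
    other {w} {z} wRz with I w in Iw
    ... | false = dom (∈-allFin w) Iw
    ... | true with I z in Iz
    ...   | true  = ⊥-elim (indep Iw Iz wRz)
    ...   | false = z , wRz , Iz

module Walks (G : Graph) where

  edge-sym : ∀ {u v} → Edge G u v → Edge G v u
  edge-sym {u} {v} e = trans (Graph.sym G v u) e

  edge-irrefl : ∀ {u} → ¬ Edge G u u
  edge-irrefl {u} e with trans (sym e) (irrefl G u)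
  ... | ()

  edge? : ∀ u v → Dec (Edge G u v)
  edge? u v = adj G u v Bool.≟ true

  infixr 5 _++ʷ_

  _++ʷ_ : ∀ {a b c} → Walk G a b → Walk G b c → Walk G a c
  []      ++ʷ q = q
  (e ∷ p) ++ʷ q = e ∷ (p ++ʷ q)

  len-++ʷ : ∀ {a b c} (p : Walk G a b) (q : Walk G b c) → len G (p ++ʷ q) ≡ len G p + len G q
  len-++ʷ []      q = refl
  len-++ʷ (e ∷ p) q = cong suc (len-++ʷ p q)

  reverseʷ : ∀ {a b} → Walk G a b → Walk G b a
  reverseʷ []      = []
  reverseʷ (e ∷ p) = reverseʷ p ++ʷ (edge-sym e ∷ [])

  unsnoc : ∀ {a z b} (e : Edge G a z) (w : Walk G z b) →
    ∃[ u ] Σ (Walk G a u) λ p → len G p ≡ len G w × Edge G u b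
  unsnoc e []      = _ , [] , refl , e
  unsnoc e (f ∷ w) with unsnoc f w
  ... | u , p , eq , g = u , e ∷ p , cong suc eq , g

  WalkOfLength : ℕ → Vertex G → Vertex G → Set
  WalkOfLength k a b = Σ (Walk G a b) λ w → len G w ≡ k

  walkOfLength? : ∀ k a b → Dec (WalkOfLength k a b)
  walkOfLength? zero a b with a Fin.≟ b
  ... | yes refl = yes ([] , refl)
  ... | no a≢b   = no λ { ([] , _) → a≢b refl }
  walkOfLength? (suc k) a b with any? (λ z → edge? a z ×-dec walkOfLength? k z b)
  ... | yes (z , e , w , refl) = yes (e ∷ w , refl)
  ... | no ∄                   = no λ { (e ∷ w , eq) → ∄ (_ , e , w , suc-injective eq) }

module Distance (G : Graph) (conn : Connected G) (x : Vertex G) where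
  open Walks G

  abstract
    private
      shortest : ∀ v → ∃[ k ] WalkOfLength k x v × (∀ {j} → j < k → ¬ WalkOfLength j x v)
      shortest v = least-witness (λ k → walkOfLength? k x v) (conn x v , refl)

    distance : Vertex G → ℕ
    distance v = proj₁ (shortest v)

    shortestWalk : ∀ v → WalkOfLength (distance v) x v
    shortestWalk v = proj₁ (proj₂ (shortest v))

    distance≤len : ∀ {v} (w : Walk G x v) → distance v ≤ len G w
    distance≤len {v} w = ≮⇒≥ λ w<d → proj₂ (proj₂ (shortest v)) w<d (w , refl)

  distance-Dist : ∀ v → Dist G x v (distance v)
  distance-Dist v = shortestWalk v , distance≤len

  distance≡0⇒≡x : ∀ {v} → distance v ≡ 0 → v ≡ x
  distance≡0⇒≡x {v} d≡0 with shortestWalk v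
  ... | []    , _   = refl
  ... | _ ∷ _ , len≡d with trans len≡d d≡0
  ...   | ()

  distance-edge : ∀ {u v} → Edge G u v → distance v ≤ suc (distance u)
  distance-edge {u} {v} e with shortestWalk u
  ... | w , len≡d = begin
    distance v                  ≤⟨ distance≤len (w ++ʷ e ∷ []) ⟩
    len G (w ++ʷ e ∷ [])        ≡⟨ len-++ʷ w (e ∷ []) ⟩
    len G w + 1                 ≡⟨ +-comm (len G w) 1 ⟩
    suc (len G w)               ≡⟨ cong suc len≡d ⟩
    suc (distance u)            ∎
    where open ≤-Reasoning

  predecessor : ∀ {v i} → distance v ≡ suc i → ∃[ u ] Edge G u v × distance u ≡ i
  predecessor {v} {i} d≡1+i with shortestWalk v
  ... | [] , len≡d with trans len≡d d≡1+i
  ...   | ()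
  predecessor {v} {i} d≡1+i | e ∷ w , len≡d with unsnoc e w
  ... | u , p , len-p , uv = u , uv , ≤-antisym du≤i i≤du
    where
    len-w : len G w ≡ i
    len-w = suc-injective (trans len≡d d≡1+i)
    du≤i : distance u ≤ i
    du≤i = subst (distance u ≤_) (trans len-p len-w) (distance≤len p)
    i≤du : i ≤ distance u
    i≤du = ≤-pred (subst (_≤ suc (distance u)) d≡1+i (distance-edge uv))

module NatColouring (G : Graph) (colour : Vertex G → Vertex G → ℕ)
                    (colour-sym : ∀ u v → colour u v ≡ colour v u) where
  open Walks G

  colourList : ∀ {a b} → Walk G a b → List ℕ
  colourList []                  = []
  colourList (_∷_ {a} {z} _ w) = colour a z ∷ colourList w

  colourList-++ʷ : ∀ {a b c} (p : Walk G a b) (q : Walk G b c) →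
    colourList (p ++ʷ q) ≡ colourList p ++ colourList q
  colourList-++ʷ []      q = refl
  colourList-++ʷ (e ∷ p) q = cong (_ ∷_) (colourList-++ʷ p q)

  colourList-reverseʷ : ∀ {a b} (p : Walk G a b) → colourList (reverseʷ p) ≡ reverse (colourList p)
  colourList-reverseʷ []                  = refl
  colourList-reverseʷ (_∷_ {a} {z} e p) = begin
    colourList (reverseʷ p ++ʷ edge-sym e ∷ [])      ≡⟨ colourList-++ʷ (reverseʷ p) _ ⟩
    colourList (reverseʷ p) ++ colour z a ∷ []      ≡⟨ cong₂ (λ cs c → cs ++ c ∷ []) (colourList-reverseʷ p) (colour-sym z a) ⟩
    reverse (colourList p) ++ colour a z ∷ []       ≡⟨ unfold-reverse (colour a z) (colourList p) ⟨
    reverse (colour a z ∷ colourList p)             ∎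
    where open ≡-Reasoning

  RainbowBelow : ℕ → ∀ {a b} → Walk G a b → Set
  RainbowBelow k w = Unique (colourList w) × All (_< k) (colourList w)

  module Bounded {k : ℕ} (colour< : ∀ {u v} → Edge G u v → colour u v < k) where

    edgeColoring : EdgeColoring G k
    edgeColoring = record
      { col     = λ u v e → fromℕ< (colour< e)
      ; col-sym = λ u v e e′ → fromℕ<-cong _ _ (colour-sym u v) _ _
      }

    toℕ-colours : ∀ {a b} (w : Walk G a b) → map toℕ (colours G edgeColoring w) ≡ colourList w
    toℕ-colours []      = refl
    toℕ-colours (e ∷ w) = cong₂ _∷_ (toℕ-fromℕ< (colour< e)) (toℕ-colours w)

    rainbow : ∀ {a b} (w : Walk G a b) → Unique (colourList w) → IsRainbow G edgeColoring w
    rainbow w u = Unique.map⁻ (subst Unique (sym (toℕ-colours w)) u)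

module Shortcut (G : Graph) {k : ℕ} (c : EdgeColoring G k) where

  open DecMembership (Fin._≟_ {n G}) using (_∈?_)

  private
    cs : ∀ {a b} → Walk G a b → List (Fin k)
    cs = colours G c

  dropUntil : ∀ {a z b} (w : Walk G z b) → a ∈ vertices G w → Walk G a b
  dropUntil []      (here refl) = []
  dropUntil (e ∷ w) (here refl) = e ∷ w
  dropUntil (_ ∷ w) (there a∈w) = dropUntil w a∈w

  dropUntil-isPath : ∀ {a z b} (w : Walk G z b) (a∈w : a ∈ vertices G w) →
    IsPath G w → IsPath G (dropUntil w a∈w)
  dropUntil-isPath []      (here refl) p       = p
  dropUntil-isPath (_ ∷ _) (here refl) p       = p
  dropUntil-isPath (_ ∷ w) (there a∈w) (_ ∷ p) = dropUntil-isPath w a∈w p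

  dropUntil-rainbow : ∀ {a z b} (w : Walk G z b) (a∈w : a ∈ vertices G w) →
    IsRainbow G c w → IsRainbow G c (dropUntil w a∈w)
  dropUntil-rainbow []      (here refl) r       = r
  dropUntil-rainbow (_ ∷ _) (here refl) r       = r
  dropUntil-rainbow (_ ∷ w) (there a∈w) (_ ∷ r) = dropUntil-rainbow w a∈w r

  dropUntil-colours : ∀ {a z b} (w : Walk G z b) (a∈w : a ∈ vertices G w) →
    cs (dropUntil w a∈w) ⊆ cs w
  dropUntil-colours []      (here refl) = id
  dropUntil-colours (_ ∷ _) (here refl) = id
  dropUntil-colours (_ ∷ w) (there a∈w) = there ∘ dropUntil-colours w a∈w

  shortcut : ∀ {a b} (w : Walk G a b) → IsRainbow G c w →
    Σ (Walk G a b) λ s → IsPath G s × IsRainbow G c s × cs s ⊆ cs w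
  shortcut []      _ = [] , [] ∷ [] , [] , id
  shortcut {a} (e ∷ w) (e∉w ∷ r) with shortcut w r
  ... | s , path , rainbow , s⊆w with a ∈? vertices G s
  ...   | yes a∈s = dropUntil s a∈s , dropUntil-isPath s a∈s path , dropUntil-rainbow s a∈s rainbow ,
                    there ∘ s⊆w ∘ dropUntil-colours s a∈s
  ...   | no a∉s  = e ∷ s , All.¬Any⇒All¬ _ a∉s ∷ path ,
                    All.tabulate (λ c∈s → All.lookup e∉w (s⊆w c∈s)) ∷ rainbow ,
                    λ { (here refl) → here refl ; (there c∈s) → there (s⊆w c∈s) }

module LevelColouring (G : Graph) (conn : Connected G) (tri : EveryEdgeInTriangle G)
                      (x : Vertex G) where
  open Walks G
  open Distance G conn x

  private
    parentOf? : ∀ v u → Dec (Edge G u v × suc (distance u) ≡ distance v)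
    parentOf? v u = edge? u v ×-dec (suc (distance u) ≟ distance v)

  parent : Vertex G → Vertex G
  parent v = choose (parentOf? v) v

  parent-spec : ∀ {v i} → distance v ≡ suc i → Edge G (parent v) v × distance (parent v) ≡ i
  parent-spec {v} dv with predecessor dv
  ... | u , uv , du with choose-satisfies (parentOf? v) v (u , uv , trans (cong suc du) (sym dv))
  ...   | pv , dp = pv , suc-injective (trans dp dv)

  SameLevelEdge : Vertex G → Vertex G → Set
  SameLevelEdge u v = Edge G u v × distance u ≡ distance v

  private
    sides : ∃[ side ] (∀ {w z} → SameLevelEdge w z → ∃[ y ] SameLevelEdge w y × side y ≡ not (side w))
    sides = neighbour-on-other-side (λ u v → edge? u v ×-dec (distance u ≟ distance v))
              (λ (e , eq) → edge-sym e , sym eq) (edge-irrefl ∘ proj₁)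

  side : Vertex G → Bool
  side = proj₁ sides

  other-side : ∀ {w z} → SameLevelEdge w z → ∃[ y ] SameLevelEdge w y × side y ≡ not (side w)
  other-side = proj₂ sides

  offset : Vertex G → Vertex G → ℕ
  offset w q = if ⌊ q Fin.≟ parent w ⌋ then bit (side w) else bit (not (side w))

  offset≤2 : ∀ w q → offset w q ≤ 2
  offset≤2 w q with ⌊ q Fin.≟ parent w ⌋
  ... | true  = bit≤2 _
  ... | false = bit≤2 _

  colour : Vertex G → Vertex G → ℕ
  colour u v with <-cmp (distance u) (distance v)
  ... | tri< _ _ _ = 3 * distance u + offset v u
  ... | tri≈ _ _ _ = 3 * pred (distance v) + 2
  ... | tri> _ _ _ = 3 * distance v + offset u v

  colour-sym : ∀ u v → colour u v ≡ colour v u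
  colour-sym u v with <-cmp (distance u) (distance v) | <-cmp (distance v) (distance u)
  ... | tri< _ _ _    | tri> _ _ _    = refl
  ... | tri> _ _ _    | tri< _ _ _    = refl
  ... | tri≈ _ du≡dv _ | tri≈ _ _ _   = cong (λ d → 3 * pred d + 2) (sym du≡dv)
  ... | tri< du<dv _ _ | tri< _ _ ¬du<dv = contradiction du<dv ¬du<dv
  ... | tri< du<dv _ _ | tri≈ _ _ ¬du<dv = contradiction du<dv ¬du<dv
  ... | tri≈ _ du≡dv _ | tri< _ dv≢du _ = contradiction (sym du≡dv) dv≢du
  ... | tri≈ _ du≡dv _ | tri> _ dv≢du _ = contradiction (sym du≡dv) dv≢du
  ... | tri> _ _ dv<du | tri> ¬dv<du _ _ = contradiction dv<du ¬dv<du
  ... | tri> _ _ dv<du | tri≈ ¬dv<du _ _ = contradiction dv<du ¬dv<du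

  colour-down : ∀ {w q} → distance w ≡ suc (distance q) → colour w q ≡ 3 * distance q + offset w q
  colour-down {w} {q} dw with <-cmp (distance w) (distance q)
  ... | tri< dw<dq _ _ = contradiction (≤-reflexive (sym dw)) (<-asym dw<dq)
  ... | tri≈ _ dw≡dq _ = contradiction (≤-reflexive (sym dw)) (<-irrefl (sym dw≡dq))
  ... | tri> _ _ _     = refl

  colour-level : ∀ {u v i} → distance u ≡ suc i → distance v ≡ suc i → colour u v ≡ 3 * i + 2
  colour-level {u} {v} du dv with <-cmp (distance u) (distance v)
  ... | tri< du<dv _ _ = contradiction du<dv (<-irrefl (trans du (sym dv)))
  ... | tri≈ _ _ _     = cong (λ d → 3 * pred d + 2) dv
  ... | tri> _ _ dv<du = contradiction dv<du (<-irrefl (trans dv (sym du)))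

  colour-parent : ∀ {w i} → distance w ≡ suc i → colour w (parent w) ≡ 3 * i + bit (side w)
  colour-parent {w} dw with parent-spec dw
  ... | _ , refl with colour-down {w} {parent w} dw
  ...   | eq with parent w Fin.≟ parent w
  ...     | yes _  = eq
  ...     | no p≢p = contradiction refl p≢p

  colour-nonparent : ∀ {w q i} → distance w ≡ suc i → distance q ≡ i → q ≢ parent w →
    colour w q ≡ 3 * i + bit (not (side w))
  colour-nonparent {w} {q} dw refl q≢p with colour-down {w} {q} dw
  ... | eq with q Fin.≟ parent w
  ...   | yes q≡p = contradiction q≡p q≢p
  ...   | no _    = eq

  same-level-positive : ∀ {u v} → Edge G u v → distance u ≡ distance v → ∃[ j ] distance v ≡ suc j
  same-level-positive {u} {v} uv du≡dv with distance v in dv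
  ... | zero  = contradiction (subst₂ (Edge G) (distance≡0⇒≡x du≡dv) (distance≡0⇒≡x dv) uv) edge-irrefl
  ... | suc j = j , refl

  colour-below : ∀ {u v} → Edge G u v → distance u ≤ distance v → colour u v < 3 * distance v
  colour-below {u} {v} uv du≤dv with m≤n⇒m<n∨m≡n du≤dv
  ... | inj₁ du<dv = subst₂ _<_ (sym (trans (colour-sym u v) (colour-down dv≡))) (cong (3 *_) (sym dv≡))
                       (proj₂ (inBand (distance u) (offset≤2 v u)))
    where
    dv≡ : distance v ≡ suc (distance u)
    dv≡ = ≤-antisym (distance-edge uv) du<dv
  ... | inj₂ du≡dv with same-level-positive uv du≡dv
  ...   | j , dv = subst₂ _<_ (sym (colour-level (trans du≡dv dv) dv)) (cong (3 *_) (sym dv))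
                     (proj₂ (inBand j ≤-refl))

  colour< : ∀ {r} → (∀ v → distance v ≤ r) → ∀ {u v} → Edge G u v → colour u v < 3 * r
  colour< {r} bound {u} {v} uv with ≤-total (distance u) (distance v)
  ... | inj₁ du≤dv = <-≤-trans (colour-below uv du≤dv) (*-monoʳ-≤ 3 (bound v))
  ... | inj₂ dv≤du = subst (_< 3 * r) (colour-sym v u)
                       (<-≤-trans (colour-below (edge-sym uv) dv≤du) (*-monoʳ-≤ 3 (bound u)))

  open NatColouring G colour colour-sym

  record Descent (i c : ℕ) (v : Vertex G) : Set where
    constructor descent
    field
      {end}   : Vertex G
      end≤    : distance end ≤ i
      walk    : Walk G v end
      rainbow : Unique (colourList walk)
      inBands : All (Band i) (colourList walk)
      avoids  : c ∉ colourList walk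

  open Descent

  descent-from-digits : ∀ {i c v u} (w : Walk G v u) → distance u ≤ i → (ds : List ℕ) →
    colourList w ≡ map (3 * i +_) ds → All (_≤ 2) ds → Unique ds → c ∉ ds → Descent i (3 * i + c) v
  descent-from-digits {i} {c} w du ds eq ds≤2 uds c∉ds with digits-inBand i ds≤2 uds c∉ds
  ... | u , b , c∉ = descent du w (subst Unique (sym eq) u) (subst (All (Band i)) (sym eq) b)
                                  (subst (3 * i + c ∉_) (sym eq) c∉)

  stay-descent : ∀ {i c v} → distance v ≤ i → Descent i c v
  stay-descent dv = descent dv [] [] [] λ ()

  parent-descent : ∀ {i c w} → distance w ≡ suc i → c ≢ 3 * i + bit (side w) → Descent i c w
  parent-descent {i} {c} {w} dw c≢ with parent-spec dw
  ... | pw , dp = descent (≤-reflexive dp) (edge-sym pw ∷ []) ([] ∷ [])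
    (subst (Band i) (sym (colour-parent dw)) (bit-inBand i (side w)) ∷ [])
    λ { (here c≡) → c≢ (trans c≡ (colour-parent dw)) }

  triangle-descent-below : ∀ {i w z} → distance w ≡ suc i → Edge G (parent w) z → Edge G w z →
    distance z ≡ i → Descent i (3 * i + bit (side w)) w
  triangle-descent-below {i} {w} dw pz wz dz = descent-from-digits (wz ∷ []) (≤-reflexive dz)
    (bit (not (side w)) ∷ []) (cong (_∷ []) (colour-nonparent dw dz z≢p))
    (bit≤2 _ ∷ []) ([] ∷ []) λ { (here eq) → bit-not≢ _ eq }
    where
    z≢p : _ ≢ parent w
    z≢p refl = edge-irrefl pz

  triangle-descent-level : ∀ {i w z} → distance w ≡ suc i → SameLevelEdge w z →
    Descent i (3 * i + bit (side w)) w
  triangle-descent-level {i} {w} dw wz with other-side wz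
  ... | y , (wy , dw≡dy) , side-y with parent-spec (trans (sym dw≡dy) dw)
  ...   | py , dpy = descent-from-digits (wy ∷ edge-sym py ∷ []) (≤-reflexive dpy)
    (2 ∷ bit (not (side w)) ∷ [])
    (cong₂ (λ a b → a ∷ b ∷ []) (colour-level dw dy) (trans (colour-parent dy) (cong (λ b → 3 * i + bit b) side-y)))
    (≤-refl ∷ bit≤2 _ ∷ [])
    (((λ eq → bit≢2 _ (sym eq)) ∷ []) ∷ [] ∷ [])
    λ { (here eq) → bit≢2 _ eq ; (there (here eq)) → bit-not≢ _ eq }
    where
    dy : distance y ≡ suc i
    dy = trans (sym dw≡dy) dw

  triangle-descent : ∀ {i w} → distance w ≡ suc i → Descent i (3 * i + bit (side w)) w
  triangle-descent {i} {w} dw with parent-spec dw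
  ... | pw , dp with tri (parent w) w pw
  ...   | z , pz , wz with ≤-suc-cases (subst (λ d → distance z ≤ suc d) dp (distance-edge pz))
  ...     | inj₂ dz = triangle-descent-level dw (wz , trans dw (sym dz))
  ...     | inj₁ dz≤i = triangle-descent-below dw pz wz (≤-antisym dz≤i i≤dz)
    where
    i≤dz : i ≤ distance z
    i≤dz = ≤-pred (subst (_≤ suc (distance z)) dw (distance-edge (edge-sym wz)))

  descend : ∀ {i v} → distance v ≤ suc i → ∀ c → Descent i c v
  descend {i} {v} dv c with ≤-suc-cases dv
  ... | inj₁ dv≤i = stay-descent dv≤i
  ... | inj₂ dv≡ with c ≟ 3 * i + bit (side v)
  ...   | yes refl = triangle-descent dv≡
  ...   | no c≢    = parent-descent dv≡ c≢

  Connects : ℕ → Set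
  Connects i = ∀ {u v} → distance u ≤ i → distance v ≤ i → Σ (Walk G u v) (RainbowBelow (3 * i))

  connects-zero : Connects 0
  connects-zero du dv with distance≡0⇒≡x (n≤0⇒n≡0 du) | distance≡0⇒≡x (n≤0⇒n≡0 dv)
  ... | refl | refl = [] , [] , []

  bridge : ∀ {i c u u′ v} → Connects i → (A : Walk G u u′) → distance u′ ≤ i →
    Unique (colourList A) → All (Band i) (colourList A) → All (_≡ c) (colourList A) →
    Descent i c v → Σ (Walk G u v) (RainbowBelow (3 * suc i))
  bridge {i} IH A du′ uA bA cA D with IH du′ (end≤ D)
  ... | M , uM , bM = A ++ʷ M ++ʷ reverseʷ (walk D) ,
    subst (λ cs → Unique cs × All (_< 3 * suc i) cs) (sym colours-eq)
      (++-unique-inRange (*-monoʳ-≤ 3 (n≤1+n i)) uA bA uM bM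
        (Unique-reverse (rainbow D)) (All-reverse (inBands D)) A#D)
    where
    colours-eq : colourList (A ++ʷ M ++ʷ reverseʷ (walk D)) ≡
                 colourList A ++ colourList M ++ reverse (colourList (walk D))
    colours-eq = begin
      colourList (A ++ʷ M ++ʷ reverseʷ (walk D))                      ≡⟨ colourList-++ʷ A _ ⟩
      colourList A ++ colourList (M ++ʷ reverseʷ (walk D))            ≡⟨ cong (colourList A ++_) (colourList-++ʷ M _) ⟩
      colourList A ++ colourList M ++ colourList (reverseʷ (walk D))  ≡⟨ cong (λ cs → colourList A ++ colourList M ++ cs) (colourList-reverseʷ (walk D)) ⟩
      colourList A ++ colourList M ++ reverse (colourList (walk D))   ∎
      where open ≡-Reasoning
    A#D : Disjoint (colourList A) (reverse (colourList (walk D)))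
    A#D (p , q) = avoids D (subst (_∈ _) (All.lookup cA p) (∈-reverse⁻ q))

  connects-suc : ∀ {i} → Connects i → Connects (suc i)
  connects-suc {i} IH {u} du dv with ≤-suc-cases du
  ... | inj₁ du≤i = bridge IH [] du≤i [] [] [] (descend dv 0)
  ... | inj₂ du≡ with parent-spec du≡
  ...   | pu , dp = bridge IH (edge-sym pu ∷ []) (≤-reflexive dp) ([] ∷ [])
    (subst (Band i) (sym (colour-parent du≡)) (bit-inBand i (side u)) ∷ []) (colour-parent du≡ ∷ [])
    (descend dv (3 * i + bit (side u)))

  connects : ∀ i → Connects i
  connects zero    = connects-zero
  connects (suc i) = connects-suc (connects i)

rc≤3*ecc : (G : Graph) → Connected G → EveryEdgeInTriangle G → ∀ {x r} → Ecc G x r → rc≤ G (3 * r)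
rc≤3*ecc G conn tri {x} {r} (within-r , _) = edgeColoring , rainbow-connected
  where
  open Distance G conn x using (distance; distance-Dist)
  open LevelColouring G conn tri x using (colour; colour-sym; colour<; connects)
  open NatColouring G colour colour-sym using (module Bounded)

  distance≤r : ∀ v → distance v ≤ r
  distance≤r v = within-r v (distance v) (distance-Dist v)

  open Bounded (colour< distance≤r)
  open Shortcut G edgeColoring using (shortcut)

  rainbow-connected : RainbowConnected G edgeColoring
  rainbow-connected u v _ with connects r (distance≤r u) (distance≤r v)
  ... | w , rainbow-w , _ with shortcut w (rainbow w rainbow-w)
  ...   | s , path , rainbow-s , _ = s , path , rainbow-s

theorem2 : (G : Graph) → Connected G → Bridgeless G → EveryEdgeInTriangle G →
    (r : ℕ) → Rad G r → rc≤ G (3 * r)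
theorem2 G conn _ tri r ((x , ecc-x) , _) = rc≤3*ecc G conn tri ecc-x
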